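{- Let $G=(V,E)$ be a finite undirected graph. The collection of all locally dense subsets of $V$ can be arranged into a sequence $B_0\subsetneq B_1\subsetneq\cdots\subsetneq B_k$ with $k\le |V|$. Moreover, $d(B_i,B_{i-1})>d(B_{i+1},B_i)$ for all $1\le i<k$.
   Context: For $X\subseteq V$, $E(X)=\{(x,y)\in E: x,y\in X\}$. For disjoint $X,Y\subseteq V$, $E(X,Y)=\{(x,y)\in E: x\in X, y\in Y\}$ and $E_m(X,Y)=E(X)\cup E(X,Y)$. For nonempty $X$, $d(X)=|E(X)|/|X|$. For nonempty $X$ disjoint from $Y$, the outer density is $d(X,Y)=|E_m(X,Y)|/|X|$; for general $X,Y$ one sets $d(X,Y)=d(X\setminus Y,Y)$. A set $W\subseteq V$ is locally dense if there do not exist a nonempty $X\subseteq W$ and a nonempty $Y\subseteq V$ with $Y\cap W=\emptyset$ such that $d(X,W\setminus X)\le d(Y,W)$. -}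

module Defs where

open import Data.Bool using (Bool; true; false; if_then_else_; _∧_)
open import Data.Nat using (ℕ; zero; suc; _∸_; _<ᵇ_)
import Data.Nat
open import Data.Fin using (Fin; toℕ)
open import Data.List using (List; map; allFin)
open import Data.Nat.ListAction using (sum)
open import Relation.Nullary using (¬_)
open import Data.Vec using (lookup)
open import Data.Integer using (+_)
open import Data.Rational.Unnormalised using (ℚᵘ; mkℚᵘ; _≤_)
open import Data.Fin.Subset using (Subset; _∈_; _∉_; _⊆_; _─_; ∣_∣; Nonempty)
open import Data.Product using (_×_; ∃)
open import Relation.Binary.PropositionalEquality using (_≡_)

record Graph (n : ℕ) : Set where
  field
    adj    : Fin n → Fin n → Bool
    sym    : ∀ i j → adj i j ≡ adj j i
    irrefl : ∀ i → adj i i ≡ false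
open Graph public

countPairs : ∀ {n} → (Fin n → Fin n → Bool) → ℕ
countPairs {n} p =
  sum (map (λ i → sum (map (λ j → if p i j then 1 else 0) (allFin n))) (allFin n))

-- |E(X)| : each undirected edge {i , j} inside X counted once (as i < j)
eIn : ∀ {n} → Graph n → Subset n → ℕ
eIn G X = countPairs (λ i j → adj G i j ∧ lookup X i ∧ lookup X j ∧ (toℕ i <ᵇ toℕ j))

-- |E(X,Y)| : edges with one endpoint in X and the other in Y
-- (used only for disjoint X, Y, where each edge is counted exactly once)
eBetween : ∀ {n} → Graph n → Subset n → Subset n → ℕ
eBetween G X Y = countPairs (λ i j → adj G i j ∧ lookup X i ∧ lookup Y j)

eM : ∀ {n} → Graph n → Subset n → Subset n → ℕ
eM G X Y = eIn G X Data.Nat.+ eBetween G X Y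

-- Only meaningful when X ∖ Y is nonempty (all uses below guarantee this);
-- denominators are encoded as  mkℚᵘ num (den ∸ 1)  i.e.  num / den.
dens : ∀ {n} → Graph n → Subset n → Subset n → ℚᵘ
dens G X Y = mkℚᵘ (+ eM G (X ─ Y) Y) (∣ X ─ Y ∣ ∸ 1)

Disjoint : ∀ {n} → Subset n → Subset n → Set
Disjoint Y W = ∀ x → x ∈ Y → x ∉ W

LocallyDense : ∀ {n} → Graph n → Subset n → Set
LocallyDense G W =
  ∀ (X Y : Subset _) → Nonempty X → X ⊆ W → Nonempty Y → Disjoint Y W →
    ¬ (dens G X (W ─ X) ≤ dens G Y W)

-- Two locally dense sets W₁, W₂ are always nested: otherwise X = W₁ ∖ W₂ and
-- Y = W₂ ∖ W₁ are nonempty, local density of W₁ and of W₂ gives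
-- d(Y, W₁) < d(X, W₁ ∖ X) and d(X, W₂) < d(Y, W₂ ∖ Y), while W₁ ∖ X ⊆ W₂ and
-- W₂ ∖ Y ⊆ W₁ give d(X, W₁ ∖ X) ≤ d(X, W₂) and d(Y, W₂ ∖ Y) ≤ d(Y, W₁), a cycle
-- of strict inequalities. Hence the locally dense sets (the empty set among
-- them, vacuously) form a strict chain, of length at most |V| + 1 because
-- cardinalities strictly increase along it. For three consecutive members
-- L ⊂ M ⊂ U, local density of M applied to X = M ∖ L and Y = U ∖ M is exactly
-- d(U, M) < d(M, L). The chain itself is obtained constructively by deciding
-- local density on every subset and inserting the locally dense ones into a
-- strictly increasing list.
module Submission where

open import Defs
open import Data.Nat using (ℕ; suc; _≤_; _<_)
open import Data.Fin.Subset using (Subset; _⊂_)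
open import Data.Product using (Σ; ∃; _×_)
open import Data.Rational.Unnormalised using () renaming (_<_ to _<ℚ_)
open import Function.Bundles using (_⇔_)
open import Relation.Binary.PropositionalEquality using (_≡_)

open import Data.Bool using (Bool; true; false; _∧_; if_then_else_)
open import Data.Empty using (⊥-elim)
open import Data.Fin using (Fin)
open import Data.Fin.Properties using (all?)
open import Data.Fin.Subset using (_∈_; _∉_; _⊆_; _─_; ∣_∣; Nonempty) renaming (⊥ to ∅)
open import Data.Fin.Subset.Properties
  using (_∈?_; _⊆?_; nonempty?; anySubset?; ⊆-antisym; ∉⊥; ∣p∣≤n; p⊂q⇒∣p∣<∣q∣;
         p─q⊆p; p─q─q≡p─q; x∈p∧x∉q⇒x∈p─q)
import Data.Integer as ℤ
import Data.Integer.Properties as ℤ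
open import Data.List using (List; []; _∷_; map; foldr; filter; length; _++_)
import Data.List as List
open import Data.List.Membership.Propositional using () renaming (_∈_ to _∈ₗ_)
open import Data.List.Membership.Propositional.Properties using (∈-filter⁺; ∈-map⁺; ∈-++⁺ˡ; ∈-++⁺ʳ)
open import Data.List.Relation.Unary.All using (All; []; _∷_)
import Data.List.Relation.Unary.All as All
open import Data.List.Relation.Unary.All.Properties using (all-filter)
open import Data.List.Relation.Unary.Any using (here; there)
open import Data.List.Relation.Unary.Any.Properties using (¬Any[])
open import Data.List.Relation.Unary.Linked using (Linked; []; [-]; _∷_; _∷′_; head′; tail)
open import Data.Maybe using (just)
open import Data.Maybe.Relation.Binary.Connected using (Connected; just)
open import Data.Nat using (zero; z≤n; s≤s; _+_; _∸_)
open import Data.Nat.ListAction using (sum)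
import Data.Nat.Properties as ℕ
open import Data.Product using (_,_; proj₁)
open import Data.Rational.Unnormalised using (mkℚᵘ; *≤*) renaming (_≤_ to _≤ℚ_)
open import Data.Rational.Unnormalised.Properties using (_≤?_; ≰⇒>; <-irrefl-≡; ≤-<-trans; <-trans)
open import Data.Sum using (_⊎_; inj₁; inj₂)
open import Data.Vec using ([]; _∷_; here; there; lookup)
open import Data.Vec.Properties using ([]=⇒lookup; lookup⇒[]=)
open import Function using (_∘_)
open import Function.Bundles using (mk⇔)
open import Relation.Nullary using (¬_; Dec; yes; no)
open import Relation.Nullary.Decidable using (decidable-stable; ¬?; _→-dec_)
open import Relation.Binary.PropositionalEquality using (refl; trans; cong; subst₂) renaming (sym to ≡-sym)

private
  variable
    n : ℕ

x∈p─q⇒x∉q : ∀ (p q : Subset n) {x} → x ∈ p ─ q → x ∉ q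
x∈p─q⇒x∉q (_ ∷ p) (true ∷ q) (there x∈p─q) (there x∈q) = x∈p─q⇒x∉q p q x∈p─q x∈q
x∈p─q⇒x∉q (_ ∷ p) (false ∷ q) (there x∈p─q) (there x∈q) = x∈p─q⇒x∉q p q x∈p─q x∈q

Disjoint⇒p─q≡p : ∀ {p q : Subset n} → Disjoint p q → p ─ q ≡ p
Disjoint⇒p─q≡p {p = p} {q} p#q =
  ⊆-antisym (p─q⊆p p q) (λ x∈p → x∈p∧x∉q⇒x∈p─q x∈p (p#q _ x∈p))

p─[p─q]⊆q : ∀ (p q : Subset n) → p ─ (p ─ q) ⊆ q
p─[p─q]⊆q p q {x} x∈p─[p─q] = decidable-stable (x ∈? q) λ x∉q →
  x∈p─q⇒x∉q p (p ─ q) x∈p─[p─q] (x∈p∧x∉q⇒x∈p─q (p─q⊆p p (p ─ q) x∈p─[p─q]) x∉q)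

q⊆p⇒p─[p─q]≡q : ∀ {p q : Subset n} → q ⊆ p → p ─ (p ─ q) ≡ q
q⊆p⇒p─[p─q]≡q {p = p} {q} q⊆p = ⊆-antisym (p─[p─q]⊆q p q) λ x∈q →
  x∈p∧x∉q⇒x∈p─q (q⊆p x∈q) (λ x∈p─q → x∈p─q⇒x∉q p q x∈p─q x∈q)

p⊈q⇒Nonempty[p─q] : ∀ {p q : Subset n} → ¬ p ⊆ q → Nonempty (p ─ q)
p⊈q⇒Nonempty[p─q] {p = p} {q} p⊈q with nonempty? (p ─ q)
... | yes p─q≢∅ = p─q≢∅
... | no p─q≡∅ = ⊥-elim (p⊈q λ {x} x∈p → decidable-stable (x ∈? q) λ x∉q →
  p─q≡∅ (x , x∈p∧x∉q⇒x∈p─q x∈p x∉q))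

p⊂q⇒Nonempty[q─p] : ∀ {p q : Subset n} → p ⊂ q → Nonempty (q ─ p)
p⊂q⇒Nonempty[q─p] (_ , x , x∈q , x∉p) = x , x∈p∧x∉q⇒x∈p─q x∈q x∉p

p⊆q∧q⊈p⇒p⊂q : ∀ {p q : Subset n} → p ⊆ q → ¬ q ⊆ p → p ⊂ q
p⊆q∧q⊈p⇒p⊂q {q = q} p⊆q q⊈p with p⊈q⇒Nonempty[p─q] q⊈p
... | x , x∈q─p = p⊆q , x , p─q⊆p q _ x∈q─p , x∈p─q⇒x∉q q _ x∈q─p

allSubsets? : ∀ {P : Subset n → Set} → (∀ s → Dec (P s)) → Dec (∀ s → P s)
allSubsets? P? with anySubset? (¬? ∘ P?)
... | yes (s , ¬Ps) = no λ ∀P → ¬Ps (∀P s)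
... | no ∄¬P = yes λ s → decidable-stable (P? s) λ ¬Ps → ∄¬P (s , ¬Ps)

subsets : ∀ n → List (Subset n)
subsets zero = [] ∷ []
subsets (suc n) = map (true ∷_) (subsets n) ++ map (false ∷_) (subsets n)

∈-subsets : ∀ (s : Subset n) → s ∈ₗ subsets n
∈-subsets [] = here refl
∈-subsets (true ∷ s) = ∈-++⁺ˡ (∈-map⁺ (true ∷_) (∈-subsets s))
∈-subsets {suc n} (false ∷ s) = ∈-++⁺ʳ (map (true ∷_) (subsets n)) (∈-map⁺ (false ∷_) (∈-subsets s))

∧-preservesʳ-true : ∀ a {b c} → (b ≡ true → c ≡ true) → a ∧ b ≡ true → a ∧ c ≡ true
∧-preservesʳ-true true b⇒c = b⇒c

countPairs-mono : ∀ {p q : Fin n → Fin n → Bool} →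
  (∀ i j → p i j ≡ true → q i j ≡ true) → countPairs p ≤ countPairs q
countPairs-mono {n} {p} {q} p⇒q =
  sum-mono (List.allFin n) λ i → sum-mono (List.allFin n) λ j → indicator-mono (p⇒q i j)
  where
  sum-mono : ∀ {A : Set} (xs : List A) {f g : A → ℕ} →
    (∀ x → f x ≤ g x) → sum (map f xs) ≤ sum (map g xs)
  sum-mono [] _ = z≤n
  sum-mono (x ∷ xs) f≤g = ℕ.+-mono-≤ (f≤g x) (sum-mono xs f≤g)

  indicator-mono : ∀ {b c} → (b ≡ true → c ≡ true) →
    (if b then 1 else 0) ≤ (if c then 1 else 0)
  indicator-mono {false} _ = z≤n
  indicator-mono {true} b⇒c rewrite b⇒c refl = ℕ.≤-refl

eM-monoʳ : ∀ (G : Graph n) X {Y Y'} → Y ⊆ Y' → eM G X Y ≤ eM G X Y'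
eM-monoʳ G X {Y} {Y'} Y⊆Y' = ℕ.+-monoʳ-≤ (eIn G X) (countPairs-mono λ i j →
  ∧-preservesʳ-true (adj G i j) (∧-preservesʳ-true (lookup X i)
    ([]=⇒lookup ∘ Y⊆Y' ∘ lookup⇒[]= j Y)))

mkℚᵘ-monoˡ-≤ : ∀ {m m'} d → m ≤ m' → mkℚᵘ (ℤ.+ m) d ≤ℚ mkℚᵘ (ℤ.+ m') d
mkℚᵘ-monoˡ-≤ d m≤m' = *≤* (ℤ.*-monoʳ-≤-nonNeg (ℤ.+ suc d) (ℤ.+≤+ m≤m'))

module _ (G : Graph n) where

  dens-─ˡ : ∀ X Y → dens G (X ─ Y) Y ≡ dens G X Y
  dens-─ˡ X Y = cong (λ Z → mkℚᵘ (ℤ.+ eM G Z Y) (∣ Z ∣ ∸ 1)) (p─q─q≡p─q X Y)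

  dens-disjoint : ∀ {X Y} → Disjoint X Y → dens G X Y ≡ mkℚᵘ (ℤ.+ eM G X Y) (∣ X ∣ ∸ 1)
  dens-disjoint {X} {Y} X#Y = cong (λ Z → mkℚᵘ (ℤ.+ eM G Z Y) (∣ Z ∣ ∸ 1)) (Disjoint⇒p─q≡p X#Y)

  dens-monoʳ : ∀ {X Y Y'} → Disjoint X Y → Disjoint X Y' → Y ⊆ Y' → dens G X Y ≤ℚ dens G X Y'
  dens-monoʳ {X} X#Y X#Y' Y⊆Y' = subst₂ _≤ℚ_ (≡-sym (dens-disjoint X#Y)) (≡-sym (dens-disjoint X#Y'))
    (mkℚᵘ-monoˡ-≤ (∣ X ∣ ∸ 1) (eM-monoʳ G X Y⊆Y'))

  dens-─-monoʳ : ∀ W W' → dens G (W ─ W') (W ─ (W ─ W')) ≤ℚ dens G (W ─ W') W'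
  dens-─-monoʳ W W' = dens-monoʳ
    (λ x x∈W─W' x∈W─[W─W'] → x∈p─q⇒x∉q W (W ─ W') x∈W─[W─W'] x∈W─W')
    (λ _ → x∈p─q⇒x∉q W W')
    (p─[p─q]⊆q W W')

module _ (G : Graph n) where

  locallyDense-∅ : LocallyDense G ∅
  locallyDense-∅ X Y (x , x∈X) X⊆∅ _ _ _ = ∉⊥ (X⊆∅ x∈X)

  locallyDense-total : ∀ {W₁ W₂} → LocallyDense G W₁ → LocallyDense G W₂ → W₁ ⊆ W₂ ⊎ W₂ ⊆ W₁
  locallyDense-total {W₁} {W₂} ld₁ ld₂ with W₁ ⊆? W₂ | W₂ ⊆? W₁
  ... | yes W₁⊆W₂ | _ = inj₁ W₁⊆W₂
  ... | no _ | yes W₂⊆W₁ = inj₂ W₂⊆W₁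
  ... | no W₁⊈W₂ | no W₂⊈W₁ = ⊥-elim (<-irrefl-≡ refl
      (≤-<-trans (dens-─-monoʳ G W₁ W₂) (<-trans by-ld₂ (≤-<-trans (dens-─-monoʳ G W₂ W₁) by-ld₁))))
    where
    X Y : Subset n
    X = W₁ ─ W₂
    Y = W₂ ─ W₁

    by-ld₁ : dens G Y W₁ <ℚ dens G X (W₁ ─ X)
    by-ld₁ = ≰⇒> (ld₁ X Y (p⊈q⇒Nonempty[p─q] W₁⊈W₂) (p─q⊆p W₁ W₂)
      (p⊈q⇒Nonempty[p─q] W₂⊈W₁) (λ _ → x∈p─q⇒x∉q W₂ W₁))

    by-ld₂ : dens G X W₂ <ℚ dens G Y (W₂ ─ Y)
    by-ld₂ = ≰⇒> (ld₂ Y X (p⊈q⇒Nonempty[p─q] W₂⊈W₁) (p─q⊆p W₂ W₁)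
      (p⊈q⇒Nonempty[p─q] W₁⊈W₂) (λ _ → x∈p─q⇒x∉q W₁ W₂))

  locallyDense-dens-< : ∀ {L M U} → LocallyDense G M → L ⊂ M → M ⊂ U →
    dens G U M <ℚ dens G M L
  locallyDense-dens-< {L} {M} {U} ld L⊂M M⊂U =
    subst₂ _<ℚ_ (dens-─ˡ G U M)
      (trans (cong (dens G (M ─ L)) (q⊆p⇒p─[p─q]≡q (proj₁ L⊂M))) (dens-─ˡ G M L))
      (≰⇒> (ld (M ─ L) (U ─ M) (p⊂q⇒Nonempty[q─p] L⊂M) (p─q⊆p M L)
        (p⊂q⇒Nonempty[q─p] M⊂U) (λ _ → x∈p─q⇒x∉q U M)))

  locallyDense? : ∀ W → Dec (LocallyDense G W)
  locallyDense? W = allSubsets? λ X → allSubsets? λ Y →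
    nonempty? X →-dec X ⊆? W →-dec nonempty? Y →-dec
    all? (λ x → x ∈? Y →-dec ¬? (x ∈? W)) →-dec ¬? (dens G X (W ─ X) ≤? dens G Y W)

insert : Subset n → List (Subset n) → List (Subset n)
insert W [] = W ∷ []
insert W (h ∷ t) with W ⊆? h | h ⊆? W
... | yes _ | yes _ = h ∷ t
... | yes _ | no _ = W ∷ h ∷ t
... | no _ | _ = h ∷ insert W t

∈-insert : ∀ (W : Subset n) t → W ∈ₗ insert W t
∈-insert W [] = here refl
∈-insert W (h ∷ t) with W ⊆? h | h ⊆? W
... | yes W⊆h | yes h⊆W = here (⊆-antisym W⊆h h⊆W)
... | yes _ | no _ = here refl
... | no _ | _ = there (∈-insert W t)

∈-insert⁺ : ∀ (W : Subset n) {t z} → z ∈ₗ t → z ∈ₗ insert W t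
∈-insert⁺ W {h ∷ t} z∈t with W ⊆? h | h ⊆? W
... | yes _ | yes _ = z∈t
... | yes _ | no _ = there z∈t
∈-insert⁺ W {h ∷ t} (here z≡h) | no _ | _ = here z≡h
∈-insert⁺ W {h ∷ t} (there z∈t) | no _ | _ = there (∈-insert⁺ W z∈t)

insert-connected : ∀ {h W : Subset n} t → h ⊂ W →
  Connected _⊂_ (just h) (List.head t) → Connected _⊂_ (just h) (List.head (insert W t))
insert-connected [] h⊂W _ = just h⊂W
insert-connected {W = W} (y ∷ t) h⊂W h⊂y with W ⊆? y | y ⊆? W
... | yes _ | yes _ = h⊂y
... | yes _ | no _ = just h⊂W
... | no _ | _ = h⊂y

module _ {P : Subset n → Set} (comparable : ∀ {a b} → P a → P b → a ⊆ b ⊎ b ⊆ a) where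

  insert-All : ∀ {W t} → P W → All P t → All P (insert W t)
  insert-All {t = []} PW [] = PW ∷ []
  insert-All {W} {h ∷ t} PW (Ph ∷ Pt) with W ⊆? h | h ⊆? W
  ... | yes _ | yes _ = Ph ∷ Pt
  ... | yes _ | no _ = PW ∷ Ph ∷ Pt
  ... | no _ | _ = Ph ∷ insert-All PW Pt

  insert-linked : ∀ {W t} → P W → All P t → Linked _⊂_ t → Linked _⊂_ (insert W t)
  insert-linked {t = []} _ _ _ = [-]
  insert-linked {W} {h ∷ t} PW (Ph ∷ Pt) chain with W ⊆? h | h ⊆? W
  ... | yes _ | yes _ = chain
  ... | yes W⊆h | no h⊈W = p⊆q∧q⊈p⇒p⊂q W⊆h h⊈W ∷ chain
  ... | no W⊈h | _ with comparable PW Ph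
  ...   | inj₁ W⊆h = ⊥-elim (W⊈h W⊆h)
  ...   | inj₂ h⊆W =
    insert-connected t (p⊆q∧q⊈p⇒p⊂q h⊆W W⊈h) (head′ chain) ∷′ insert-linked PW Pt (tail chain)

  chainOf : List (Subset n) → List (Subset n)
  chainOf = foldr insert []

  chainOf-All : ∀ {L} → All P L → All P (chainOf L)
  chainOf-All [] = []
  chainOf-All (PW ∷ PL) = insert-All PW (chainOf-All PL)

  chainOf-linked : ∀ {L} → All P L → Linked _⊂_ (chainOf L)
  chainOf-linked [] = []
  chainOf-linked (PW ∷ PL) = insert-linked PW (chainOf-All PL) (chainOf-linked PL)

  ∈-chainOf : ∀ {L z} → z ∈ₗ L → z ∈ₗ chainOf L
  ∈-chainOf {W ∷ L} (here refl) = ∈-insert W (chainOf L)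
  ∈-chainOf {W ∷ L} (there z∈L) = ∈-insert⁺ W (∈-chainOf z∈L)

Linked-⊂-length : ∀ {x : Subset n} {xs} → Linked _⊂_ (x ∷ xs) → ∣ x ∣ + length xs ≤ n
Linked-⊂-length {x = x} [-] rewrite ℕ.+-identityʳ ∣ x ∣ = ∣p∣≤n x
Linked-⊂-length {n} {x} {y ∷ ys} (x⊂y ∷ chain) = begin
  ∣ x ∣ + suc (length ys) ≡⟨ ℕ.+-suc ∣ x ∣ (length ys) ⟩
  suc ∣ x ∣ + length ys   ≤⟨ ℕ.+-monoˡ-≤ (length ys) (p⊂q⇒∣p∣<∣q∣ x⊂y) ⟩
  ∣ y ∣ + length ys       ≤⟨ Linked-⊂-length chain ⟩
  n                       ∎
  where open ℕ.≤-Reasoning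

nth : ∀ {A : Set} → A → List A → ℕ → A
nth d [] _ = d
nth d (x ∷ xs) zero = x
nth d (x ∷ xs) (suc i) = nth d xs i

nth-∈ : ∀ {A : Set} {d : A} xs {i} → i < length xs → nth d xs i ∈ₗ xs
nth-∈ (x ∷ xs) {zero} _ = here refl
nth-∈ (x ∷ xs) {suc i} (s≤s i<n) = there (nth-∈ xs i<n)

∈⇒nth : ∀ {A : Set} {d z : A} {xs} → z ∈ₗ xs → ∃ λ i → i < length xs × nth d xs i ≡ z
∈⇒nth (here refl) = zero , s≤s z≤n , refl
∈⇒nth (there z∈xs) with ∈⇒nth z∈xs
... | i , i<n , nth≡z = suc i , s≤s i<n , nth≡z

Linked-nth : ∀ {A : Set} {R : A → A → Set} {d : A} {xs i} → Linked R xs →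
  suc i < length xs → R (nth d xs i) (nth d xs (suc i))
Linked-nth [-] (s≤s ())
Linked-nth {i = zero} (Rxy ∷ _) _ = Rxy
Linked-nth {i = suc i} (_ ∷ chain) (s≤s i+1<n) = Linked-nth chain i+1<n

module _ (G : Graph n) where

  locallyDenseChain : List (Subset n)
  locallyDenseChain = chainOf (locallyDense-total G) (filter (locallyDense? G) (subsets n))

  locallyDenseChain-linked : Linked _⊂_ locallyDenseChain
  locallyDenseChain-linked =
    chainOf-linked (locallyDense-total G) (all-filter (locallyDense? G) (subsets n))

  locallyDenseChain-sound : All (LocallyDense G) locallyDenseChain
  locallyDenseChain-sound =
    chainOf-All (locallyDense-total G) (all-filter (locallyDense? G) (subsets n))

  locallyDenseChain-complete : ∀ {W} → LocallyDense G W → W ∈ₗ locallyDenseChain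
  locallyDenseChain-complete {W} ld =
    ∈-chainOf (locallyDense-total G) (∈-filter⁺ (locallyDense? G) (∈-subsets W) ld)

corollary1 : ∀ {n} (G : Graph n) →
    Σ ℕ λ k → Σ (ℕ → Subset n) λ B →
      (k ≤ n)
      × (∀ i → i < k → B i ⊂ B (suc i))
      × (∀ W → LocallyDense G W ⇔ (∃ λ i → i ≤ k × B i ≡ W))
      × (∀ j → suc j < k →
           dens G (B (suc (suc j))) (B (suc j)) <ℚ dens G (B (suc j)) (B j))
corollary1 G
  with locallyDenseChain G | locallyDenseChain-linked G
     | locallyDenseChain-sound G | locallyDenseChain-complete G
... | [] | _ | _ | complete = ⊥-elim (¬Any[] (complete (locallyDense-∅ G)))
... | x ∷ xs | chain | sound | complete =
  length xs , B ,
  ℕ.≤-trans (ℕ.m≤n+m (length xs) ∣ x ∣) (Linked-⊂-length chain) ,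
  (λ i i<k → Linked-nth chain (s≤s i<k)) ,
  (λ W → mk⇔ (λ ld → position (complete ld)) (λ { (i , i≤k , refl) → locallyDense-B (s≤s i≤k) })) ,
  (λ j j+1<k → locallyDense-dens-< G (locallyDense-B (ℕ.m<n⇒m<1+n j+1<k))
    (Linked-nth chain (ℕ.m<n⇒m<1+n j+1<k)) (Linked-nth chain (s≤s j+1<k)))
  where
  B : ℕ → Subset _
  B = nth ∅ (x ∷ xs)

  locallyDense-B : ∀ {i} → i < suc (length xs) → LocallyDense G (B i)
  locallyDense-B i<n = All.lookup sound (nth-∈ (x ∷ xs) i<n)

  position : ∀ {W} → W ∈ₗ x ∷ xs → ∃ λ i → i ≤ length xs × B i ≡ W
  position W∈ with ∈⇒nth W∈
  ... | i , s≤s i≤k , Bi≡W = i , i≤k , Bi≡W
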